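{- Let $\pi$ be a $\mu\mathrm{LL}^\infty$ pre-proof and let $(p_i)_{i\in\omega}$ be an infinite sequence of rule permutations starting from $\pi$ with finite permutation of rules. Then the associated sequence of pre-proofs $(\pi_i)_{i\in\omega}$ converges (to a $\mu\mathrm{LL}^\infty$ pre-proof).
   Context: $\mu\mathrm{LL}^\infty$ is linear logic (with exponentials $!,?$ and rules weakening $?_{\mathrm w}$, dereliction $?_{\mathrm d}$, contraction $?_{\mathrm c}$, promotion) extended with least and greatest fixed points $\mu X.F$, $\nu X.F$ and unfolding rules (from $\vdash F[\delta X.F/X],\Gamma$ infer $\vdash \delta X.F,\Gamma$ for $\delta\in\{\mu,\nu\}$). A pre-proof is a possibly infinite (non-wellfounded) tree of sequents built with these rules. Positions in a pre-proof are words over $\{l,r,i\}$: $i$ moves to the premise of a unary rule, $l$ (resp. $r$) to the left (resp. right) premise of a binary rule. A one-step rule permutation at the root, $\mathrm{perm}(\pi,\epsilon)$, is defined when the last two rules of $\pi$ are two consecutive rules among $?_{\mathrm w},?_{\mathrm d},?_{\mathrm c}$ acting on distinct formula occurrences (e.g. $?_{\mathrm c}$ on $?A$ followed by $?_{\mathrm d}$ introducing $?B$); it yields the pre-proof in which these two rule applications are performed in the opposite order (the intermediate sequent being adjusted, the rest unchanged); otherwise it is undefined. This is extended to positions: $\mathrm{perm}(q(\pi'), i\cdot p') := q(\mathrm{perm}(\pi',p'))$ for a unary last rule $q$; $\mathrm{perm}(q(\pi_l,\pi_r), l\cdot p') := q(\mathrm{perm}(\pi_l,p'),\pi_r)$ and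 $\mathrm{perm}(q(\pi_l,\pi_r), r\cdot p') := q(\pi_l,\mathrm{perm}(\pi_r,p'))$ for a binary last rule $q$; undefined in all other cases or when the recursive call is undefined. A sequence of rule permutations starting from $\pi$ is a sequence $(p_i)_{i\in\lambda}$ of positions such that, with $\pi_0:=\pi$ and $\pi_{i+1}:=\mathrm{perm}(\pi_i,p_i)$, all $\pi_i$ are defined; $(\pi_i)$ is the associated sequence of pre-proofs. For a rule $(r)$ of $\pi_0$ whose conclusion is at position $q$, its sequence of residuals $(q_i)$ is defined by $q_0:=q$; $q_{i+1}:=q_i\cdot i$ if $p_i=q_i$; $q_{i+1}:=p_i$ if $q_i=p_i\cdot i$; $q_{i+1}:=q_i$ otherwise. The rule is finitely permuted if its sequence of residuals is ultimately constant, and the sequence $(p_i)$ has finite permutation of rules if every rule of $\pi_0$ is finitely permuted. A sequence of pre-proofs converges if for every depth $d$ the pre-proofs are eventually all equal up to depth $d$ (convergence for the usual tree topology). -}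

module Defs where

open import Data.Nat using (ℕ; zero; suc; _+_; _∸_; _≤_; _<_; _<ᵇ_; _≡ᵇ_)
open import Data.Bool using (Bool; true; false; if_then_else_; _∨_; not)
open import Data.List using (List; []; _∷_; _++_; length; take; drop)
open import Data.List.Relation.Unary.All using (All)
open import Data.List.Properties using (≡-dec)
open import Data.Maybe using (Maybe; just; nothing; map)
open import Data.Product using (Σ; ∃; _×_; _,_)
open import Relation.Binary.PropositionalEquality using (_≡_; refl; _≢_)
open import Relation.Nullary using (Dec; yes; no; ¬_)

-- Formulas of μLL (fixed-point variables as de Bruijn indices)

data Formula : Set where
  atom natom     : ℕ → Formula
  var            : ℕ → Formula
  one bot top zer : Formula
  _⊗_ _⅋_ _&_ _⊕_ : Formula → Formula → Formula
  !_ ¿_          : Formula → Formula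
  μ ν            : Formula → Formula      -- μX.F, νX.F  (X = var 0 in F)

-- linear negation (X⊥ = X, as usual for fixed-point variables)
dual : Formula → Formula
dual (atom n) = natom n
dual (natom n) = atom n
dual (var n) = var n
dual one = bot
dual bot = one
dual top = zer
dual zer = top
dual (A ⊗ B) = dual A ⅋ dual B
dual (A ⅋ B) = dual A ⊗ dual B
dual (A & B) = dual A ⊕ dual B
dual (A ⊕ B) = dual A & dual B
dual (! A) = ¿ dual A
dual (¿ A) = ! dual A
dual (μ F) = ν (dual F)
dual (ν F) = μ (dual F)

data WF (n : ℕ) : Formula → Set where
  atom  : ∀ k → WF n (atom k)
  natom : ∀ k → WF n (natom k)
  var   : ∀ {k} → k < n → WF n (var k)
  one   : WF n one
  bot   : WF n bot
  top   : WF n top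
  zer   : WF n zer
  tens  : ∀ {A B} → WF n A → WF n B → WF n (A ⊗ B)
  par   : ∀ {A B} → WF n A → WF n B → WF n (A ⅋ B)
  with' : ∀ {A B} → WF n A → WF n B → WF n (A & B)
  plus  : ∀ {A B} → WF n A → WF n B → WF n (A ⊕ B)
  bang  : ∀ {A} → WF n A → WF n (! A)
  whyn  : ∀ {A} → WF n A → WF n (¿ A)
  mu    : ∀ {F} → WF (suc n) F → WF n (μ F)
  nu    : ∀ {F} → WF (suc n) F → WF n (ν F)

Closed : Formula → Set
Closed = WF 0

shift : ℕ → Formula → Formula
shift c (var n) = if n <ᵇ c then var n else var (suc n)
shift c (atom n) = atom n
shift c (natom n) = natom n
shift c one = one
shift c bot = bot
shift c top = top
shift c zer = zer
shift c (A ⊗ B) = shift c A ⊗ shift c B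
shift c (A ⅋ B) = shift c A ⅋ shift c B
shift c (A & B) = shift c A & shift c B
shift c (A ⊕ B) = shift c A ⊕ shift c B
shift c (! A) = ! shift c A
shift c (¿ A) = ¿ shift c A
shift c (μ F) = μ (shift (suc c) F)
shift c (ν F) = ν (shift (suc c) F)

subst : ℕ → Formula → Formula → Formula
subst k G (var n) = if n <ᵇ k then var n else (if n ≡ᵇ k then G else var (n ∸ 1))
subst k G (atom n) = atom n
subst k G (natom n) = natom n
subst k G one = one
subst k G bot = bot
subst k G top = top
subst k G zer = zer
subst k G (A ⊗ B) = subst k G A ⊗ subst k G B
subst k G (A ⅋ B) = subst k G A ⅋ subst k G B
subst k G (A & B) = subst k G A & subst k G B
subst k G (A ⊕ B) = subst k G A ⊕ subst k G B
subst k G (! A) = ! subst k G A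
subst k G (¿ A) = ¿ subst k G A
subst k G (μ F) = μ (subst (suc k) (shift 0 G) F)
subst k G (ν F) = ν (subst (suc k) (shift 0 G) F)

unfoldμ unfoldν : Formula → Formula
unfoldμ F = subst 0 (μ F) F
unfoldν F = subst 0 (ν F) F

-- Sequents: ordered lists of formula occurrences; an occurrence is an index.

Sequent : Set
Sequent = List Formula

lookupM : Sequent → ℕ → Maybe Formula
lookupM [] _ = nothing
lookupM (A ∷ Γ) zero = just A
lookupM (A ∷ Γ) (suc k) = lookupM Γ k

replaceAt : Sequent → ℕ → List Formula → Sequent
replaceAt Γ k Δ = take k Γ ++ Δ ++ drop (suc k) Γ

filterB : Bool → List Bool → Sequent → Sequent
filterB b [] _ = []
filterB b (_ ∷ _) [] = []
filterB b (c ∷ s) (A ∷ Γ) = if (c Data.Bool.∧ b) ∨ (not c Data.Bool.∧ not b)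
                              then A ∷ filterB b s Γ else filterB b s Γ

data IsWhyNot : Formula → Set where
  isWhyNot : ∀ A → IsWhyNot (¿ A)

data SKind : Set where
  wk der ctr : SKind

-- Rule labels (the index is the position of the principal occurrence in
-- the conclusion; the List Bool is the context split of a binary rule:
-- true = left premise, false = right premise).
data Rule : Set where
  ax     : Rule
  cut    : Formula → List Bool → Rule
  tensR  : ℕ → List Bool → Rule
  parR   : ℕ → Rule
  withR  : ℕ → Rule
  plus1R plus2R : ℕ → Rule
  oneR   : Rule
  botR   : ℕ → Rule
  topR   : ℕ → Rule
  struct : SKind → ℕ → Rule
  prom   : ℕ → Rule
  muR nuR : ℕ → Rule

data Prem : Set where
  none : Prem
  one1 : Sequent → Prem
  two  : Sequent → Sequent → Prem

-- instances of the rules:  Γ ⊢ r ⇒ P  (conclusion Γ, premises P)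
data _⊢_⇒_ : Sequent → Rule → Prem → Set where
  ax-r    : ∀ A → (A ∷ dual A ∷ []) ⊢ ax ⇒ none
  cut-r   : ∀ {Γ A s} → length s ≡ length Γ →
            Γ ⊢ cut A s ⇒ two (A ∷ filterB true s Γ) (dual A ∷ filterB false s Γ)
  tens-r  : ∀ {Γ k s A B} → lookupM Γ k ≡ just (A ⊗ B) → length s ≡ length Γ ∸ 1 →
            Γ ⊢ tensR k s ⇒ two (A ∷ filterB true s (replaceAt Γ k []))
                                (B ∷ filterB false s (replaceAt Γ k []))
  par-r   : ∀ {Γ k A B} → lookupM Γ k ≡ just (A ⅋ B) →
            Γ ⊢ parR k ⇒ one1 (replaceAt Γ k (A ∷ B ∷ []))
  with-r  : ∀ {Γ k A B} → lookupM Γ k ≡ just (A & B) →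
            Γ ⊢ withR k ⇒ two (replaceAt Γ k (A ∷ [])) (replaceAt Γ k (B ∷ []))
  plus1-r : ∀ {Γ k A B} → lookupM Γ k ≡ just (A ⊕ B) →
            Γ ⊢ plus1R k ⇒ one1 (replaceAt Γ k (A ∷ []))
  plus2-r : ∀ {Γ k A B} → lookupM Γ k ≡ just (A ⊕ B) →
            Γ ⊢ plus2R k ⇒ one1 (replaceAt Γ k (B ∷ []))
  one-r   : (one ∷ []) ⊢ oneR ⇒ none
  bot-r   : ∀ {Γ k} → lookupM Γ k ≡ just bot → Γ ⊢ botR k ⇒ one1 (replaceAt Γ k [])
  top-r   : ∀ {Γ k} → lookupM Γ k ≡ just top → Γ ⊢ topR k ⇒ none
  wk-r    : ∀ {Γ k A} → lookupM Γ k ≡ just (¿ A) →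
            Γ ⊢ struct wk k ⇒ one1 (replaceAt Γ k [])
  der-r   : ∀ {Γ k A} → lookupM Γ k ≡ just (¿ A) →
            Γ ⊢ struct der k ⇒ one1 (replaceAt Γ k (A ∷ []))
  ctr-r   : ∀ {Γ k A} → lookupM Γ k ≡ just (¿ A) →
            Γ ⊢ struct ctr k ⇒ one1 (replaceAt Γ k (¿ A ∷ ¿ A ∷ []))
  prom-r  : ∀ {Γ k A} → lookupM Γ k ≡ just (! A) → All IsWhyNot (replaceAt Γ k []) →
            Γ ⊢ prom k ⇒ one1 (replaceAt Γ k (A ∷ []))
  mu-r    : ∀ {Γ k F} → lookupM Γ k ≡ just (μ F) →
            Γ ⊢ muR k ⇒ one1 (replaceAt Γ k (unfoldμ F ∷ []))
  nu-r    : ∀ {Γ k F} → lookupM Γ k ≡ just (ν F) →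
            Γ ⊢ nuR k ⇒ one1 (replaceAt Γ k (unfoldν F ∷ []))

data Dir : Set where
  l r i : Dir

_≟D_ : (a b : Dir) → Dec (a ≡ b)
l ≟D l = yes refl
l ≟D r = no λ ()
l ≟D i = no λ ()
r ≟D l = no λ ()
r ≟D r = yes refl
r ≟D i = no λ ()
i ≟D l = no λ ()
i ≟D r = no λ ()
i ≟D i = yes refl

Pos : Set
Pos = List Dir

_≟P_ : (p q : Pos) → Dec (p ≡ q)
_≟P_ = ≡-dec _≟D_

Node : Set
Node = Sequent × Rule

-- A tree is given by the (partial) labelling of positions by nodes
-- (conclusion sequent and rule applied there).
Tree : Set
Tree = Pos → Maybe Node

data Arity : Set where
  nullary unary binary : Arity

arity : Rule → Arity
arity ax = nullary
arity (cut _ _) = binary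
arity (tensR _ _) = binary
arity (parR _) = unary
arity (withR _) = binary
arity (plus1R _) = unary
arity (plus2R _) = unary
arity oneR = nullary
arity (botR _) = unary
arity (topR _) = nullary
arity (struct _ _) = unary
arity (prom _) = unary
arity (muR _) = unary
arity (nuR _) = unary

seqOf : Maybe Node → Maybe Sequent
seqOf = map Data.Product.proj₁

MatchPrem : Prem → (Dir → Maybe Node) → Set
MatchPrem none ch = ∀ d → ch d ≡ nothing
MatchPrem (one1 Δ) ch = seqOf (ch i) ≡ just Δ × ch l ≡ nothing × ch r ≡ nothing
MatchPrem (two Δ Δ') ch = seqOf (ch l) ≡ just Δ × seqOf (ch r) ≡ just Δ' × ch i ≡ nothing

LocalOK : Maybe Node → (Dir → Maybe Node) → Set
LocalOK nothing ch = ∀ d → ch d ≡ nothing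
LocalOK (just (Γ , ρ)) ch = All Closed Γ × Σ Prem λ P → (Γ ⊢ ρ ⇒ P) × MatchPrem P ch

PreProof : Tree → Set
PreProof t = (t [] ≢ nothing) × (∀ p → LocalOK (t p) (λ d → t (p ++ d ∷ [])))

-- premise position j of rule (κ at k) ↦ conclusion position (for non-active j)
ancestor : SKind → ℕ → ℕ → ℕ
ancestor wk k j = if j <ᵇ k then j else suc j
ancestor der k j = j
ancestor ctr k j = if j <ᵇ k then j else j ∸ 1

-- conclusion position j ≠ k of rule (κ at k) ↦ premise position
descendant : SKind → ℕ → ℕ → ℕ
descendant wk k j = if j <ᵇ k then j else j ∸ 1
descendant der k j = j
descendant ctr k j = if j <ᵇ k then j else suc j

active : SKind → ℕ → ℕ → Bool
active wk k j = false
active der k j = j ≡ᵇ k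
active ctr k j = (j ≡ᵇ k) ∨ (j ≡ᵇ suc k)

structPrem : SKind → ℕ → Sequent → Maybe Sequent
structPrem κ k Γ with lookupM Γ k
structPrem wk  k Γ | just (¿ A) = just (replaceAt Γ k [])
structPrem der k Γ | just (¿ A) = just (replaceAt Γ k (A ∷ []))
structPrem ctr k Γ | just (¿ A) = just (replaceAt Γ k (¿ A ∷ ¿ A ∷ []))
structPrem κ k Γ | _ = nothing

permRoot : Tree → Maybe Tree
permRoot t with t [] | t (i ∷ [])
... | just (Γ , struct κ₁ k₁) | just (Γ' , struct κ₂ k₂) =
  if active κ₁ k₁ k₂ then nothing else
    (let k₂' = ancestor κ₁ k₁ k₂
         k₁' = descendant κ₂ k₂' k₁
     in map (λ Δ → λ { [] → just (Γ , struct κ₂ k₂')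
                     ; (i ∷ []) → just (Δ , struct κ₁ k₁')
                     ; p → t p })
            (structPrem κ₂ k₂' Γ))
... | _ | _ = nothing

sub : Tree → Dir → Tree
sub t d p = t (d ∷ p)

graft : Tree → Dir → Tree → Tree
graft t d t' [] = t []
graft t d t' (d' ∷ p) with d' ≟D d
... | yes _ = t' p
... | no _ = t (d' ∷ p)

dirOK : Arity → Dir → Bool
dirOK unary i = true
dirOK binary l = true
dirOK binary r = true
dirOK _ _ = false

perm : Tree → Pos → Maybe Tree
perm t [] = permRoot t
perm t (d ∷ p) with t []
... | nothing = nothing
... | just (Γ , ρ) =
  if dirOK (arity ρ) d then map (graft t d) (perm (sub t d) p) else nothing

_≈_ : Tree → Tree → Set
t ≈ t' = ∀ p → t p ≡ t' p

_≈M_ : Maybe Tree → Tree → Set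
nothing ≈M t' = Data.Empty.⊥ where import Data.Empty
just t ≈M t' = t ≈ t'

IsPermSeq : Tree → (ℕ → Pos) → (ℕ → Tree) → Set
IsPermSeq π ps πs = (πs 0 ≈ π) × (∀ n → perm (πs n) (ps n) ≈M πs (suc n))

resStep : Pos → Pos → Pos
resStep p q with q ≟P p
... | yes _ = q ++ i ∷ []
... | no _ with q ≟P (p ++ i ∷ [])
...   | yes _ = p
...   | no _ = q

residual : (ℕ → Pos) → Pos → ℕ → Pos
residual ps q zero = q
residual ps q (suc n) = resStep (ps n) (residual ps q n)

FinitelyPermuted : (ℕ → Pos) → Pos → Set
FinitelyPermuted ps q = ∃ λ N → ∀ n → N ≤ n → residual ps q n ≡ residual ps q N

FinitePermutationOfRules : Tree → (ℕ → Pos) → Set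
FinitePermutationOfRules π ps = ∀ q (nd : Node) → π q ≡ just nd → FinitelyPermuted ps q

AgreeUpTo : ℕ → Tree → Tree → Set
AgreeUpTo d t t' = ∀ p → length p ≤ d → t p ≡ t' p

Converges : (ℕ → Tree) → Set
Converges πs = ∀ d → ∃ λ N → ∀ m n → N ≤ m → N ≤ n → AgreeUpTo d (πs m) (πs n)

ConvergesTo : (ℕ → Tree) → Tree → Set
ConvergesTo πs lim = ∀ d → ∃ λ N → ∀ n → N ≤ n → AgreeUpTo d (πs n) lim

-- The permutation at position p only changes the nodes at p and p ++ i, so it suffices to show that
-- for every depth d the positions p_n eventually lie deeper than d.  The rule permuted at step n has
-- an origin o_n in π, and since its residual moves at step n, o_n has not settled by time n.  Fix d and
-- a time N after which all rules of π of depth at most d + 1 have settled.  If p_n has depth at most d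
-- and n ≥ N, then by pigeonhole along the i-branch through p_n one of these settled rules lies strictly
-- below p_n; since positions strictly above settled rules are only permuted among themselves, o_n
-- ranges over a finite set of rules of π determined by N.  Once all of them have settled, no further
-- p_n has depth at most d.
module Submission where

open import Defs
open import Data.Nat using (ℕ; zero; suc; _+_; _∸_; _≤_; _<_; _<ᵇ_; s≤s; _⊔_; _≤?_; _<?_)
open import Data.Nat.Properties
  using (≤-refl; ≤-trans; ≤-reflexive; ≤-pred; ≰⇒>; ≮⇒≥; <⇒≱; <⇒≢; n<1+n; n≤1+n; m≤n⇒m≤1+n;
         m≤m+n; m≤n+m; m≤m⊔n; m≤n⊔m; +-comm; +-suc; +-monoʳ-≤; +-cancelˡ-≡; m∸n+n≡m; m+[n∸m]≡n)
open import Data.Bool using (true; false)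
open import Data.Fin using (Fin; toℕ; fromℕ<)
open import Data.Fin.Properties using (pigeonhole; ¬∀⟶∃¬; toℕ-fromℕ<; toℕ<n)
open import Data.List using (List; []; _∷_; _++_; length; replicate; map; concatMap)
open import Data.List.Properties
  using (++-assoc; ++-identityʳ; ++-identityʳ-unique; ∷ʳ-injectiveˡ; ∷-injectiveʳ;
         length-++; length-replicate)
open import Data.List.Relation.Unary.All using (All; []; _∷_)
import Data.List.Relation.Unary.All.Properties as All
open import Data.List.Relation.Unary.Any using (here; there)
open import Data.List.Membership.Propositional using (_∈_)
open import Data.List.Membership.Propositional.Properties using (∈-++⁺ˡ; ∈-++⁺ʳ; ∈-map⁺; ∈-concat⁺′)
open import Data.Maybe using (Maybe; just; nothing)
open import Data.Product using (Σ; ∃; ∃₂; _×_; _,_; proj₁; proj₂)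
open import Data.Empty using (⊥-elim)
open import Relation.Binary.PropositionalEquality
  using (_≡_; refl; _≢_; sym; trans; cong; module ≡-Reasoning)
  renaming (subst to ≡-subst; subst₂ to ≡-subst₂)
open import Relation.Nullary using (¬_; yes; no)
open ≡-Reasoning

lookupM-replaceAt-< : ∀ Γ k j L {X} → lookupM Γ k ≡ just X → j < k →
                      lookupM (replaceAt Γ k L) j ≡ lookupM Γ j
lookupM-replaceAt-< (x ∷ Γ) (suc k) zero    L _ _         = refl
lookupM-replaceAt-< (x ∷ Γ) (suc k) (suc j) L e (s≤s j<k) = lookupM-replaceAt-< Γ k j L e j<k

lookupM-++ : ∀ (L Γ : Sequent) m → lookupM (L ++ Γ) (length L + m) ≡ lookupM Γ m
lookupM-++ []      Γ m = refl
lookupM-++ (_ ∷ L) Γ m = lookupM-++ L Γ m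

lookupM-replaceAt-≥ : ∀ Γ k m L {X} → lookupM Γ k ≡ just X →
                      lookupM (replaceAt Γ k L) (k + (length L + m)) ≡ lookupM Γ (suc k + m)
lookupM-replaceAt-≥ (x ∷ Γ) zero    m L _ = lookupM-++ L Γ m
lookupM-replaceAt-≥ (x ∷ Γ) (suc k) m L e = lookupM-replaceAt-≥ Γ k m L e

replaceAt-++ : ∀ (L Γ : Sequent) m L′ → replaceAt (L ++ Γ) (length L + m) L′ ≡ L ++ replaceAt Γ m L′
replaceAt-++ []      Γ m L′ = refl
replaceAt-++ (x ∷ L) Γ m L′ = cong (x ∷_) (replaceAt-++ L Γ m L′)

replaceAt-comm : ∀ Γ k m L₁ L₂ {X} → lookupM Γ (suc k + m) ≡ just X →
                 replaceAt (replaceAt Γ (suc k + m) L₁) k L₂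
                   ≡ replaceAt (replaceAt Γ k L₂) (k + (length L₂ + m)) L₁
replaceAt-comm (x ∷ Γ) zero    m L₁ L₂ _ = sym (replaceAt-++ L₂ Γ m L₁)
replaceAt-comm (x ∷ Γ) (suc k) m L₁ L₂ e = cong (x ∷_) (replaceAt-comm Γ k m L₁ L₂ e)

All-lookupM : ∀ {P : Formula → Set} Γ k {X} → All P Γ → lookupM Γ k ≡ just X → P X
All-lookupM (x ∷ Γ) zero    (px ∷ _)  refl = px
All-lookupM (x ∷ Γ) (suc k) (_ ∷ pΓ) e    = All-lookupM Γ k pΓ e

All-replaceAt : ∀ {P : Formula → Set} Γ k L {X} → All P Γ → lookupM Γ k ≡ just X → All P L →
                All P (replaceAt Γ k L)
All-replaceAt (x ∷ Γ) zero    L (_ ∷ pΓ)  _ pL = All.++⁺ pL pΓ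
All-replaceAt (x ∷ Γ) (suc k) L (px ∷ pΓ) e pL = px ∷ All-replaceAt Γ k L pΓ e pL

-- Commuting two structural rules

premiseFormulas : SKind → Formula → List Formula
premiseFormulas wk  A = []
premiseFormulas der A = A ∷ []
premiseFormulas ctr A = ¿ A ∷ ¿ A ∷ []

width : SKind → ℕ
width wk  = 0
width der = 1
width ctr = 2

length-premiseFormulas : ∀ κ A → length (premiseFormulas κ A) ≡ width κ
length-premiseFormulas wk  A = refl
length-premiseFormulas der A = refl
length-premiseFormulas ctr A = refl

struct-inversion : ∀ {Γ κ k Γ₁} → Γ ⊢ struct κ k ⇒ one1 Γ₁ →
                   ∃ λ A → lookupM Γ k ≡ just (¿ A) × Γ₁ ≡ replaceAt Γ k (premiseFormulas κ A)
struct-inversion (wk-r  {A = A} e) = A , e , refl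
struct-inversion (der-r {A = A} e) = A , e , refl
struct-inversion (ctr-r {A = A} e) = A , e , refl

struct-rule : ∀ κ {Γ k A Γ₁} → lookupM Γ k ≡ just (¿ A) →
              Γ₁ ≡ replaceAt Γ k (premiseFormulas κ A) → Γ ⊢ struct κ k ⇒ one1 Γ₁
struct-rule wk  e refl = wk-r e
struct-rule der e refl = der-r e
struct-rule ctr e refl = ctr-r e

structPrem-≡ : ∀ κ Γ k {A} → lookupM Γ k ≡ just (¿ A) →
               structPrem κ k Γ ≡ just (replaceAt Γ k (premiseFormulas κ A))
structPrem-≡ wk  Γ k e rewrite e = refl
structPrem-≡ der Γ k e rewrite e = refl
structPrem-≡ ctr Γ k e rewrite e = refl

All-Closed-premiseFormulas : ∀ κ {A} → Closed (¿ A) → All Closed (premiseFormulas κ A)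
All-Closed-premiseFormulas wk  _          = []
All-Closed-premiseFormulas der (whyn cA) = cA ∷ []
All-Closed-premiseFormulas ctr cA        = cA ∷ cA ∷ []

-- An occurrence k₂ of the premise of the rule κ at k₁ lies before or after the width κ
-- occurrences that the rule puts in place of k₁.
data Apart (κ : SKind) : ℕ → ℕ → Set where
  before : ∀ k₂ m → Apart κ (suc k₂ + m) k₂
  after  : ∀ k₁ m → Apart κ k₁ (k₁ + (width κ + m))

Apart-suc : ∀ {κ k₁ k₂} → Apart κ k₁ k₂ → Apart κ (suc k₁) (suc k₂)
Apart-suc (before k₂ m) = before (suc k₂) m
Apart-suc (after k₁ m)  = after (suc k₁) m

apart : ∀ κ k₁ k₂ → active κ k₁ k₂ ≡ false → Apart κ k₁ k₂
apart κ   (suc k₁) zero           _ = before 0 k₁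
apart wk  (suc k₁) (suc k₂)       h = Apart-suc (apart wk k₁ k₂ h)
apart der (suc k₁) (suc k₂)       h = Apart-suc (apart der k₁ k₂ h)
apart ctr (suc k₁) (suc k₂)       h = Apart-suc (apart ctr k₁ k₂ h)
apart wk  zero     k₂             _ = after 0 k₂
apart der zero     (suc k₂)       _ = after 0 k₂
apart ctr zero     (suc (suc k₂)) _ = after 0 k₂

<ᵇ-true : ∀ {m n} → m < n → (m <ᵇ n) ≡ true
<ᵇ-true {zero}  {suc n} _         = refl
<ᵇ-true {suc m} {suc n} (s≤s m<n) = <ᵇ-true m<n

<ᵇ-false : ∀ {m n} → n ≤ m → (m <ᵇ n) ≡ false
<ᵇ-false {m}     {zero}  _         = refl
<ᵇ-false {suc m} {suc n} (s≤s n≤m) = <ᵇ-false n≤m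

n<1+n+m : ∀ n m → n < suc n + m
n<1+n+m n m = s≤s (m≤m+n n m)

ancestor-before : ∀ κ k m → ancestor κ (suc k + m) k ≡ k
ancestor-before wk  k m rewrite <ᵇ-true (n<1+n+m k m) = refl
ancestor-before der k m = refl
ancestor-before ctr k m rewrite <ᵇ-true (n<1+n+m k m) = refl

descendant-before : ∀ κ k m → descendant κ k (suc k + m) ≡ k + (width κ + m)
descendant-before wk  k m rewrite <ᵇ-false (≤-trans (m≤m+n k m) (n≤1+n _)) = refl
descendant-before der k m = sym (+-suc k m)
descendant-before ctr k m rewrite <ᵇ-false (≤-trans (m≤m+n k m) (n≤1+n _)) =
  sym (trans (+-suc k (suc m)) (cong suc (+-suc k m)))

ancestor-after : ∀ κ k m → ancestor κ k (k + (width κ + m)) ≡ suc k + m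
ancestor-after wk  k m rewrite <ᵇ-false (m≤m+n k m) = refl
ancestor-after der k m = +-suc k m
ancestor-after ctr k m rewrite <ᵇ-false (m≤m+n k (2 + m)) =
  cong (_∸ 1) (trans (+-suc k (suc m)) (cong suc (+-suc k m)))

descendant-after : ∀ κ k m → descendant κ (suc k + m) k ≡ k
descendant-after wk  k m rewrite <ᵇ-true (n<1+n+m k m) = refl
descendant-after der k m = refl
descendant-after ctr k m rewrite <ᵇ-true (n<1+n+m k m) = refl

swap-struct : ∀ {Γ Γ₁ Γ₂ κ₁ κ₂ k₁ k₂} → All Closed Γ →
              Γ ⊢ struct κ₁ k₁ ⇒ one1 Γ₁ → Γ₁ ⊢ struct κ₂ k₂ ⇒ one1 Γ₂ → Apart κ₁ k₁ k₂ →
              ∃ λ Δ → structPrem κ₂ (ancestor κ₁ k₁ k₂) Γ ≡ just Δ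
                    × Γ ⊢ struct κ₂ (ancestor κ₁ k₁ k₂) ⇒ one1 Δ
                    × Δ ⊢ struct κ₁ (descendant κ₂ (ancestor κ₁ k₁ k₂) k₁) ⇒ one1 Γ₂
                    × All Closed Δ
swap-struct {Γ} {κ₁ = κ₁} {κ₂} cl r₁ r₂ (before k₂ m)
  with struct-inversion r₁ | struct-inversion r₂
... | A , e₁ , refl | B , e₂ , refl
  rewrite ancestor-before κ₁ k₂ m | descendant-before κ₂ k₂ m =
  Δ , structPrem-≡ κ₂ Γ k₂ e₂′ , struct-rule κ₂ e₂′ refl , struct-rule κ₁ e₃ Γ₂≡ ,
  All-replaceAt Γ k₂ L₂ cl e₂′ (All-Closed-premiseFormulas κ₂ (All-lookupM Γ k₂ cl e₂′))
  where
  L₁ L₂ : List Formula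
  L₁ = premiseFormulas κ₁ A
  L₂ = premiseFormulas κ₂ B
  Δ : Sequent
  Δ = replaceAt Γ k₂ L₂
  atWidth : ∀ {P : ℕ → Set} → P (k₂ + (length L₂ + m)) → P (k₂ + (width κ₂ + m))
  atWidth {P} = ≡-subst (λ w → P (k₂ + (w + m))) (length-premiseFormulas κ₂ B)
  e₂′ : lookupM Γ k₂ ≡ just (¿ B)
  e₂′ = trans (sym (lookupM-replaceAt-< Γ (suc k₂ + m) k₂ L₁ e₁ (n<1+n+m k₂ m))) e₂
  e₃ : lookupM Δ (k₂ + (width κ₂ + m)) ≡ just (¿ A)
  e₃ = atWidth {λ j → lookupM Δ j ≡ just (¿ A)} (trans (lookupM-replaceAt-≥ Γ k₂ m L₂ e₂′) e₁)
  Γ₂≡ : replaceAt (replaceAt Γ (suc k₂ + m) L₁) k₂ L₂ ≡ replaceAt Δ (k₂ + (width κ₂ + m)) L₁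
  Γ₂≡ = atWidth {λ j → replaceAt (replaceAt Γ (suc k₂ + m) L₁) k₂ L₂ ≡ replaceAt Δ j L₁}
                (replaceAt-comm Γ k₂ m L₁ L₂ e₁)
swap-struct {Γ} {κ₁ = κ₁} {κ₂} cl r₁ r₂ (after k₁ m)
  with struct-inversion r₁ | struct-inversion r₂
... | A , e₁ , refl | B , e₂ , refl
  rewrite ancestor-after κ₁ k₁ m | descendant-after κ₂ k₁ m =
  Δ , structPrem-≡ κ₂ Γ (suc k₁ + m) e₂′ , struct-rule κ₂ e₂′ refl , struct-rule κ₁ e₃ Γ₂≡ ,
  All-replaceAt Γ (suc k₁ + m) L₂ cl e₂′ (All-Closed-premiseFormulas κ₂ (All-lookupM Γ _ cl e₂′))
  where
  L₁ L₂ : List Formula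
  L₁ = premiseFormulas κ₁ A
  L₂ = premiseFormulas κ₂ B
  Δ : Sequent
  Δ = replaceAt Γ (suc k₁ + m) L₂
  atWidth : ∀ {P : ℕ → Set} → P (k₁ + (length L₁ + m)) → P (k₁ + (width κ₁ + m))
  atWidth {P} = ≡-subst (λ w → P (k₁ + (w + m))) (length-premiseFormulas κ₁ A)
  e₂′ : lookupM Γ (suc k₁ + m) ≡ just (¿ B)
  e₂′ = trans (sym (atWidth {λ j → lookupM (replaceAt Γ k₁ L₁) j ≡ lookupM Γ (suc k₁ + m)}
                             (lookupM-replaceAt-≥ Γ k₁ m L₁ e₁)))
              e₂
  e₃ : lookupM Δ k₁ ≡ just (¿ A)
  e₃ = trans (lookupM-replaceAt-< Γ (suc k₁ + m) k₁ L₂ e₂′ (n<1+n+m k₁ m)) e₁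
  Γ₂≡ : replaceAt (replaceAt Γ k₁ L₁) (k₁ + (width κ₁ + m)) L₂ ≡ replaceAt Δ k₁ L₁
  Γ₂≡ = sym (atWidth {λ j → replaceAt Δ k₁ L₁ ≡ replaceAt (replaceAt Γ k₁ L₁) j L₂}
                     (replaceAt-comm Γ k₁ m L₂ L₁ e₂′))

-- Positions and residuals

p++i≢p : ∀ (p : Pos) → p ++ i ∷ [] ≢ p
p++i≢p p e with () ← ++-identityʳ-unique p (sym e)

data StepCase (p q : Pos) : Set where
  at        : q ≡ p → StepCase p q
  below     : q ≡ p ++ i ∷ [] → StepCase p q
  elsewhere : q ≢ p → q ≢ p ++ i ∷ [] → StepCase p q

stepCase : ∀ p q → StepCase p q
stepCase p q with q ≟P p
... | yes q≡p = at q≡p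
... | no q≢p with q ≟P (p ++ i ∷ [])
...   | yes q≡pi = below q≡pi
...   | no q≢pi  = elsewhere q≢p q≢pi

resStep-at : ∀ p → resStep p p ≡ p ++ i ∷ []
resStep-at p with p ≟P p
... | yes _   = refl
... | no p≢p = ⊥-elim (p≢p refl)

resStep-below : ∀ p → resStep p (p ++ i ∷ []) ≡ p
resStep-below p with (p ++ i ∷ []) ≟P p
... | yes e = ⊥-elim (p++i≢p p e)
... | no _ with (p ++ i ∷ []) ≟P (p ++ i ∷ [])
...   | yes _ = refl
...   | no n  = ⊥-elim (n refl)

resStep-elsewhere : ∀ {p q} → q ≢ p → q ≢ p ++ i ∷ [] → resStep p q ≡ q
resStep-elsewhere {p} {q} q≢p q≢pi with q ≟P p
... | yes e = ⊥-elim (q≢p e)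
... | no _ with q ≟P (p ++ i ∷ [])
...   | yes e = ⊥-elim (q≢pi e)
...   | no _  = refl

resStep-involutive : ∀ p q → resStep p (resStep p q) ≡ q
resStep-involutive p q with stepCase p q
... | at refl            = trans (cong (resStep p) (resStep-at p)) (resStep-below p)
... | below refl         = trans (cong (resStep p) (resStep-below p)) (resStep-at p)
... | elsewhere q≢p q≢pi =
  trans (cong (resStep p) (resStep-elsewhere q≢p q≢pi)) (resStep-elsewhere q≢p q≢pi)

resStep-preserves : ∀ (P : Pos → Set) p q → P p → P (p ++ i ∷ []) → P q → P (resStep p q)
resStep-preserves P p q Pp Ppi Pq with stepCase p q
... | at refl            rewrite resStep-at p = Ppi
... | below refl         rewrite resStep-below p = Pp
... | elsewhere q≢p q≢pi rewrite resStep-elsewhere q≢p q≢pi = Pq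

infix 4 _⊏_

_⊏_ : Pos → Pos → Set
y ⊏ q = ∃₂ λ d rest → q ≡ y ++ d ∷ rest

⊏-trans : ∀ {x y z} → x ⊏ y → y ⊏ z → x ⊏ z
⊏-trans {x} (d , rest , refl) (d′ , rest′ , refl) =
  d , rest ++ d′ ∷ rest′ , ++-assoc x (d ∷ rest) (d′ ∷ rest′)

⊏-++i : ∀ p → p ⊏ p ++ i ∷ []
⊏-++i p = i , [] , refl

⊏-step : ∀ {y q} → y ⊏ q → (∀ d rest → q ≡ y ++ d ∷ rest → d ≡ i) → q ≢ y ++ i ∷ [] →
         y ++ i ∷ [] ⊏ q
⊏-step {y} (d , rest , q≡) through q≢yi with through d rest q≡
⊏-step {y} (d , []        , q≡) _ q≢yi | refl = ⊥-elim (q≢yi q≡)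
⊏-step {y} (d , d′ ∷ rest , q≡) _ _    | refl = d′ , rest , trans q≡ (sym (++-assoc y (i ∷ []) (d′ ∷ rest)))

strictPrefixes : Pos → List Pos
strictPrefixes []      = []
strictPrefixes (d ∷ q) = [] ∷ map (d ∷_) (strictPrefixes q)

∈-strictPrefixes : ∀ y q → y ⊏ q → y ∈ strictPrefixes q
∈-strictPrefixes []      _ (d , rest , refl) = here refl
∈-strictPrefixes (x ∷ y) _ (d , rest , refl) =
  there (∈-map⁺ (x ∷_) (∈-strictPrefixes y _ (d , rest , refl)))

positionsUpTo : ℕ → List Pos
positionsUpTo zero    = [] ∷ []
positionsUpTo (suc n) =
  [] ∷ map (l ∷_) (positionsUpTo n) ++ map (r ∷_) (positionsUpTo n) ++ map (i ∷_) (positionsUpTo n)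

∈-positionsUpTo : ∀ n q → length q ≤ n → q ∈ positionsUpTo n
∈-positionsUpTo zero    []      _         = here refl
∈-positionsUpTo (suc n) []      _         = here refl
∈-positionsUpTo (suc n) (l ∷ q) (s≤s q≤n) =
  there (∈-++⁺ˡ (∈-map⁺ (l ∷_) (∈-positionsUpTo n q q≤n)))
∈-positionsUpTo (suc n) (r ∷ q) (s≤s q≤n) =
  there (∈-++⁺ʳ (map (l ∷_) (positionsUpTo n)) (∈-++⁺ˡ (∈-map⁺ (r ∷_) (∈-positionsUpTo n q q≤n))))
∈-positionsUpTo (suc n) (i ∷ q) (s≤s q≤n) =
  there (∈-++⁺ʳ (map (l ∷_) (positionsUpTo n))
          (∈-++⁺ʳ (map (r ∷_) (positionsUpTo n)) (∈-map⁺ (i ∷_) (∈-positionsUpTo n q q≤n))))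

lane : Pos → ℕ → Pos
lane c n = c ++ replicate n i

NoTrailingI : Pos → Set
NoTrailingI c = ∀ p → c ≢ p ++ i ∷ []

lane-+ : ∀ c m n → lane c (m + n) ≡ lane c m ++ replicate n i
lane-+ c m n = trans (cong (c ++_) (replicate-+ m)) (sym (++-assoc c (replicate m i) (replicate n i)))
  where
  replicate-+ : ∀ m → replicate (m + n) i ≡ replicate m i ++ replicate n i
  replicate-+ zero    = refl
  replicate-+ (suc m) = cong (i ∷_) (replicate-+ m)

lane-suc : ∀ c n → lane c n ++ i ∷ [] ≡ lane c (suc n)
lane-suc c n = trans (sym (lane-+ c n 1)) (cong (lane c) (+-comm n 1))

length-lane : ∀ c n → length (lane c n) ≡ length c + n
length-lane c n = trans (length-++ c) (cong (length c +_) (length-replicate n))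

lane-injective : ∀ c {m n} → lane c m ≡ lane c n → m ≡ n
lane-injective c {m} {n} e =
  +-cancelˡ-≡ (length c) m n (trans (sym (length-lane c m)) (trans (cong length e) (length-lane c n)))

lane-⊏ : ∀ c {m n} → m < n → lane c m ⊏ lane c n
lane-⊏ c {m} (s≤s {n = n} m≤n) =
  i , replicate (n ∸ m) i ,
  trans (cong (lane c) (trans (cong suc (sym (m+[n∸m]≡n m≤n))) (sym (+-suc m (n ∸ m)))))
        (lane-+ c m (suc (n ∸ m)))

lane-decomposition : ∀ p → ∃₂ λ c n → NoTrailingI c × p ≡ lane c n
lane-decomposition []      = [] , 0 , (λ { [] () ; (_ ∷ _) () }) , refl
lane-decomposition (d ∷ p) with lane-decomposition p
... | [] , n , _ , refl with d
...   | i = [] , suc n , (λ { [] () ; (_ ∷ _) () }) , refl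
...   | l = l ∷ [] , n , (λ { [] () ; (_ ∷ []) () ; (_ ∷ _ ∷ _) () }) , refl
...   | r = r ∷ [] , n , (λ { [] () ; (_ ∷ []) () ; (_ ∷ _ ∷ _) () }) , refl
lane-decomposition (d ∷ p) | (d′ ∷ c) , n , c-ok , refl = d ∷ d′ ∷ c , n , dc-ok , refl
  where
  dc-ok : NoTrailingI (d ∷ d′ ∷ c)
  dc-ok []      ()
  dc-ok (_ ∷ q) e = c-ok q (∷-injectiveʳ e)

resStep-lane : ∀ {c} → NoTrailingI c → ∀ p n → ∃ λ n′ → resStep p (lane c n) ≡ lane c n′
resStep-lane {c} c-ok p n with stepCase p (lane c n)
... | at refl            = suc n , trans (resStep-at (lane c n)) (lane-suc c n)
... | elsewhere q≢p q≢pi = n , resStep-elsewhere q≢p q≢pi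
resStep-lane {c} c-ok p zero    | below e = ⊥-elim (c-ok p (trans (sym (++-identityʳ c)) e))
resStep-lane {c} c-ok p (suc n) | below e =
  n , trans (cong (resStep p) e)
            (trans (resStep-below p) (sym (∷ʳ-injectiveˡ (lane c n) p (trans (lane-suc c n) e))))

∈-concatMap : ∀ {A B : Set} (f : A → List B) {x y xs} → x ∈ xs → y ∈ f x → y ∈ concatMap f xs
∈-concatMap f x∈xs y∈fx = ∈-concat⁺′ y∈fx (∈-map⁺ f x∈xs)

maxOver : ∀ {A : Set} → (A → ℕ) → List A → ℕ
maxOver f []       = 0
maxOver f (x ∷ xs) = f x ⊔ maxOver f xs

≤-maxOver : ∀ {A : Set} (f : A → ℕ) {x xs} → x ∈ xs → f x ≤ maxOver f xs
≤-maxOver f {x} {_ ∷ xs} (here refl) = m≤m⊔n (f x) (maxOver f xs)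
≤-maxOver f {x} {y ∷ xs} (there x∈xs) = ≤-trans (≤-maxOver f x∈xs) (m≤n⊔m (f y) (maxOver f xs))

injective-reaches : ∀ k (g : ℕ → ℕ) → (∀ x y → g x ≡ g y → x ≡ y) → ∃ λ x → x ≤ k × k ≤ g x
injective-reaches k g g-inj =
  let x , gx≮k = ¬∀⟶∃¬ (suc k) (λ x → g (toℕ x) < k) (λ x → g (toℕ x) <? k) ¬all-below
  in toℕ x , ≤-pred (toℕ<n x) , ≮⇒≥ gx≮k
  where
  ¬all-below : ¬ (∀ (x : Fin (suc k)) → g (toℕ x) < k)
  ¬all-below all<k with pigeonhole (n<1+n k) (λ x → fromℕ< (all<k x))
  ... | x , y , x<y , fx≡fy =
    <⇒≢ x<y (g-inj _ _
      (trans (sym (toℕ-fromℕ< (all<k x))) (trans (cong toℕ fx≡fy) (toℕ-fromℕ< (all<k y)))))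

Defined : Tree → Pos → Set
Defined t q = ∃ λ nd → t q ≡ just nd

seqOf-nothing : ∀ (x : Maybe Node) → seqOf x ≡ nothing → x ≡ nothing
seqOf-nothing nothing  _ = refl

MatchPrem-cong : ∀ P {ch ch′ : Dir → Maybe Node} → (∀ d → seqOf (ch d) ≡ seqOf (ch′ d)) →
                 MatchPrem P ch → MatchPrem P ch′
MatchPrem-cong none {ch′ = ch′} h m d = seqOf-nothing (ch′ d) (trans (sym (h d)) (cong seqOf (m d)))
MatchPrem-cong (one1 Δ) {ch′ = ch′} h (mi , ml , mr) =
  trans (sym (h i)) mi ,
  seqOf-nothing (ch′ l) (trans (sym (h l)) (cong seqOf ml)) ,
  seqOf-nothing (ch′ r) (trans (sym (h r)) (cong seqOf mr))
MatchPrem-cong (two Δ Δ′) {ch′ = ch′} h (ml , mr , mi) =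
  trans (sym (h l)) ml , trans (sym (h r)) mr ,
  seqOf-nothing (ch′ i) (trans (sym (h i)) (cong seqOf mi))

LocalOK-cong : ∀ x {ch ch′ : Dir → Maybe Node} → (∀ d → seqOf (ch d) ≡ seqOf (ch′ d)) →
               LocalOK x ch → LocalOK x ch′
LocalOK-cong nothing {ch′ = ch′} h ok d = seqOf-nothing (ch′ d) (trans (sym (h d)) (cong seqOf (ok d)))
LocalOK-cong (just _) h (cl , P , rule , m) = cl , P , rule , MatchPrem-cong P h m

PreProof-≈ : ∀ {t t′} → t ≈ t′ → PreProof t → PreProof t′
PreProof-≈ {t} {t′} t≈t′ (root , local) =
  (λ e → root (trans (t≈t′ []) e)) ,
  λ q → ≡-subst (λ x → LocalOK x (λ d → t′ (q ++ d ∷ []))) (t≈t′ q)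
          (LocalOK-cong (t q) (λ d → cong seqOf (t≈t′ (q ++ d ∷ []))) (local q))

data Shape : Arity → Prem → Set where
  nullary : Shape nullary none
  unary   : ∀ {Δ} → Shape unary (one1 Δ)
  binary  : ∀ {Δ Δ′} → Shape binary (two Δ Δ′)

shape : ∀ {Γ ρ P} → Γ ⊢ ρ ⇒ P → Shape (arity ρ) P
shape (ax-r _)     = nullary
shape (cut-r _)    = binary
shape (tens-r _ _) = binary
shape (par-r _)    = unary
shape (with-r _)   = binary
shape (plus1-r _)  = unary
shape (plus2-r _)  = unary
shape one-r        = nullary
shape (bot-r _)    = unary
shape (top-r _)    = nullary
shape (wk-r _)     = unary
shape (der-r _)    = unary
shape (ctr-r _)    = unary
shape (prom-r _ _) = unary
shape (mu-r _)     = unary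
shape (nu-r _)     = unary

premise-defined : ∀ {a P d} {ch : Dir → Maybe Node} → Shape a P → MatchPrem P ch →
                  dirOK a d ≡ true → ch d ≢ nothing
premise-defined {d = i} unary  (mi , _)     _ e with () ← trans (sym mi) (cong seqOf e)
premise-defined {d = l} binary (ml , _)     _ e with () ← trans (sym ml) (cong seqOf e)
premise-defined {d = r} binary (_ , mr , _) _ e with () ← trans (sym mr) (cong seqOf e)

struct-local : ∀ {Γ κ k} {ch : Dir → Maybe Node} → LocalOK (just (Γ , struct κ k)) ch →
               ∃ λ Γ₁ → All Closed Γ × Γ ⊢ struct κ k ⇒ one1 Γ₁ × MatchPrem (one1 Γ₁) ch
struct-local (cl , one1 Γ₁ , rule , m) = Γ₁ , cl , rule , m

record PermStep (t u : Tree) (p : Pos) : Set where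
  field
    unchanged      : ∀ q → q ≢ p → q ≢ p ++ i ∷ [] → u q ≡ t q
    structural     : ∃ λ Γ → ∃ λ κ → ∃ λ k → t p ≡ just (Γ , struct κ k)
    defined-below  : Defined t (p ++ i ∷ [])
    defined-at′    : Defined u p
    defined-below′ : Defined u (p ++ i ∷ [])
    same-root      : seqOf (u []) ≡ seqOf (t [])
    preproof       : PreProof u

permRoot-step : ∀ t u → PreProof t → permRoot t ≡ just u → PermStep t u []
permRoot-step t u pt eq with t [] in e₀ | t (i ∷ []) in e₁ | proj₂ pt [] | proj₂ pt (i ∷ [])
permRoot-step t u pt () | nothing | _ | _ | _
permRoot-step t u pt () | just (_ , ax) | _ | _ | _
permRoot-step t u pt () | just (_ , cut _ _) | _ | _ | _
permRoot-step t u pt () | just (_ , tensR _ _) | _ | _ | _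
permRoot-step t u pt () | just (_ , parR _) | _ | _ | _
permRoot-step t u pt () | just (_ , withR _) | _ | _ | _
permRoot-step t u pt () | just (_ , plus1R _) | _ | _ | _
permRoot-step t u pt () | just (_ , plus2R _) | _ | _ | _
permRoot-step t u pt () | just (_ , oneR) | _ | _ | _
permRoot-step t u pt () | just (_ , botR _) | _ | _ | _
permRoot-step t u pt () | just (_ , topR _) | _ | _ | _
permRoot-step t u pt () | just (_ , prom _) | _ | _ | _
permRoot-step t u pt () | just (_ , muR _) | _ | _ | _
permRoot-step t u pt () | just (_ , nuR _) | _ | _ | _
permRoot-step t u pt () | just (_ , struct _ _) | nothing | _ | _
permRoot-step t u pt () | just (_ , struct _ _) | just (_ , ax) | _ | _
permRoot-step t u pt () | just (_ , struct _ _) | just (_ , cut _ _) | _ | _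
permRoot-step t u pt () | just (_ , struct _ _) | just (_ , tensR _ _) | _ | _
permRoot-step t u pt () | just (_ , struct _ _) | just (_ , parR _) | _ | _
permRoot-step t u pt () | just (_ , struct _ _) | just (_ , withR _) | _ | _
permRoot-step t u pt () | just (_ , struct _ _) | just (_ , plus1R _) | _ | _
permRoot-step t u pt () | just (_ , struct _ _) | just (_ , plus2R _) | _ | _
permRoot-step t u pt () | just (_ , struct _ _) | just (_ , oneR) | _ | _
permRoot-step t u pt () | just (_ , struct _ _) | just (_ , botR _) | _ | _
permRoot-step t u pt () | just (_ , struct _ _) | just (_ , topR _) | _ | _
permRoot-step t u pt () | just (_ , struct _ _) | just (_ , prom _) | _ | _
permRoot-step t u pt () | just (_ , struct _ _) | just (_ , muR _) | _ | _
permRoot-step t u pt () | just (_ , struct _ _) | just (_ , nuR _) | _ | _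
permRoot-step t u pt eq | just (Γ , struct κ₁ k₁) | just (Γ′ , struct κ₂ k₂) | ok₀ | ok₁
  with active κ₁ k₁ k₂ in act
permRoot-step t u pt () | just (Γ , struct κ₁ k₁) | just (Γ′ , struct κ₂ k₂) | ok₀ | ok₁ | true
... | false with struct-local {ch = λ d → t (d ∷ [])} ok₀ | struct-local ok₁
... | Γ₁ , cl , r₁ , m₀@(seq₁ , _) | Γ₂ , _ , r₂ , m₁ with trans (sym (cong seqOf e₁)) seq₁
... | refl with swap-struct cl r₁ r₂ (apart κ₁ k₁ k₂ act)
... | Δ , prem , r₂′ , r₁′ , clΔ with structPrem κ₂ (ancestor κ₁ k₁ k₂) Γ | prem
permRoot-step t u pt refl | just (Γ , struct κ₁ k₁) | just (Γ′ , struct κ₂ k₂) | ok₀ | ok₁ | false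
  | Γ₁ , cl , r₁ , m₀@(seq₁ , _) | Γ₂ , _ , r₂ , m₁ | refl | Δ , prem , r₂′ , r₁′ , clΔ | just .Δ | refl =
  record { unchanged = unchanged ; structural = Γ , κ₁ , k₁ , e₀ ; defined-below = _ , e₁
         ; defined-at′ = _ , refl ; defined-below′ = _ , refl
         ; same-root = cong seqOf (sym e₀) ; preproof = (λ ()) , local }
  where
  unchanged : ∀ q → q ≢ [] → q ≢ i ∷ [] → u q ≡ t q
  unchanged []          q≢[] _    = ⊥-elim (q≢[] refl)
  unchanged (l ∷ q)     _    _    = refl
  unchanged (r ∷ q)     _    _    = refl
  unchanged (i ∷ [])    _    q≢i = ⊥-elim (q≢i refl)
  unchanged (i ∷ d ∷ q) _    _    = refl
  local : ∀ q → LocalOK (u q) (λ d → u (q ++ d ∷ []))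
  local []          = cl , one1 Δ , r₂′ , (refl , proj₂ m₀)
  local (i ∷ [])    = clΔ , one1 Γ₂ , r₁′ , m₁
  local (l ∷ q)     = proj₂ pt (l ∷ q)
  local (r ∷ q)     = proj₂ pt (r ∷ q)
  local (i ∷ d ∷ q) = proj₂ pt (i ∷ d ∷ q)

graft-here : ∀ t d s q → graft t d s (d ∷ q) ≡ s q
graft-here t d s q with d ≟D d
... | yes _ = refl
... | no d≢d = ⊥-elim (d≢d refl)

perm-step : ∀ p t u → PreProof t → perm t p ≡ just u → PermStep t u p
perm-step []      t u pt eq = permRoot-step t u pt eq
perm-step (d ∷ p) t u pt eq with t [] in e₀ | proj₂ pt []
... | just (Γ , ρ) | ok₀@(_ , _ , rule , m) with dirOK (arity ρ) d in d-ok
... | true with perm (sub t d) p in e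
perm-step (d ∷ p) t u pt refl | just (Γ , ρ) | ok₀@(_ , _ , rule , m) | true | just s =
  record { unchanged = unchanged ; structural = PermStep.structural IH
         ; defined-below = PermStep.defined-below IH
         ; defined-at′ = lift p (PermStep.defined-at′ IH)
         ; defined-below′ = lift (p ++ i ∷ []) (PermStep.defined-below′ IH)
         ; same-root = refl ; preproof = root , local }
  where
  IH : PermStep (sub t d) s p
  IH = perm-step p (sub t d) s (premise-defined (shape rule) m d-ok , λ q → proj₂ pt (d ∷ q)) e
  lift : ∀ q → Defined s q → Defined (graft t d s) (d ∷ q)
  lift q (nd , e′) = nd , trans (graft-here t d s q) e′
  unchanged : ∀ q → q ≢ d ∷ p → q ≢ (d ∷ p) ++ i ∷ [] → graft t d s q ≡ t q
  unchanged []       _    _     = refl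
  unchanged (d′ ∷ q) q≢p q≢pi with d′ ≟D d
  ... | yes refl = PermStep.unchanged IH q (λ e → q≢p (cong (d ∷_) e)) (λ e → q≢pi (cong (d ∷_) e))
  ... | no _     = refl
  root : graft t d s [] ≢ nothing
  root e′ with () ← trans (sym e₀) e′
  children : ∀ d′ → seqOf (t (d′ ∷ [])) ≡ seqOf (graft t d s (d′ ∷ []))
  children d′ with d′ ≟D d
  ... | yes refl = sym (PermStep.same-root IH)
  ... | no _     = refl
  local : ∀ q → LocalOK (graft t d s q) (λ d′ → graft t d s (q ++ d′ ∷ []))
  local [] = ≡-subst (λ x → LocalOK x (λ d′ → graft t d s (d′ ∷ []))) (sym e₀)
                     (LocalOK-cong (just (Γ , ρ)) children ok₀)
  local (d′ ∷ q) with d′ ≟D d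
  ... | yes refl = proj₂ (PermStep.preproof IH) q
  ... | no _     = proj₂ pt (d′ ∷ q)

PermStep-≈ : ∀ {t u u′ p} → u ≈ u′ → PermStep t u p → PermStep t u′ p
PermStep-≈ {u = u} {u′ = u′} u≈u′ s = record
  { unchanged      = λ q q≢p q≢pi → trans (sym (u≈u′ q)) (unchanged q q≢p q≢pi)
  ; structural     = structural
  ; defined-below  = defined-below
  ; defined-at′    = transport defined-at′
  ; defined-below′ = transport defined-below′
  ; same-root      = trans (cong seqOf (sym (u≈u′ []))) same-root
  ; preproof       = PreProof-≈ u≈u′ preproof
  }
  where
  open PermStep s
  transport : ∀ {q} → Defined u q → Defined u′ q
  transport {q} (nd , e) = nd , trans (sym (u≈u′ q)) e

module _ {t u p} (s : PermStep t u p) where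
  open PermStep s

  PermStep-defined-at : Defined t p
  PermStep-defined-at = let _ , _ , _ , e = structural in _ , e

  PermStep-defined⁺ : ∀ q → Defined t q → Defined u q
  PermStep-defined⁺ q (nd , e) with stepCase p q
  ... | at refl            = defined-at′
  ... | below refl         = defined-below′
  ... | elsewhere q≢p q≢pi = nd , trans (unchanged q q≢p q≢pi) e

  PermStep-defined⁻ : ∀ q → Defined u q → Defined t q
  PermStep-defined⁻ q (nd , e) with stepCase p q
  ... | at refl            = PermStep-defined-at
  ... | below refl         = defined-below
  ... | elsewhere q≢p q≢pi = nd , trans (sym (unchanged q q≢p q≢pi)) e

Defined-prefix : ∀ {t} → PreProof t → ∀ q rest → Defined t (q ++ rest) → Defined t q
Defined-prefix {t} pt q []         dq = ≡-subst (Defined t) (++-identityʳ q) dq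
Defined-prefix {t} pt q (d ∷ rest) dq
  with t q | proj₂ pt q
     | Defined-prefix pt (q ++ d ∷ []) rest (≡-subst (Defined t) (sym (++-assoc q (d ∷ []) rest)) dq)
... | just nd | _  | _            = nd , refl
... | nothing | ok | (_ , e) with () ← trans (sym e) (ok d)

struct-premise-i : ∀ {t} → PreProof t → ∀ p {Γ κ k} → t p ≡ just (Γ , struct κ k) →
                   ∀ d rest → Defined t (p ++ d ∷ rest) → d ≡ i
struct-premise-i {t} pt p e d rest dq
  with struct-local (≡-subst (λ x → LocalOK x (λ d → t (p ++ d ∷ []))) e (proj₂ pt p))
     | Defined-prefix pt (p ++ d ∷ []) rest (≡-subst (Defined t) (sym (++-assoc p (d ∷ []) rest)) dq)
... | _ , _ , _ , _ , l-none , r-none | _ , e′ with d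
...   | i = refl
...   | l with () ← trans (sym e′) l-none
...   | r with () ← trans (sym e′) r-none

-- Convergence

module Convergence (π : Tree) (π-pre : PreProof π) (ps : ℕ → Pos) (πs : ℕ → Tree)
                   (perm-seq : IsPermSeq π ps πs) (finite : FinitePermutationOfRules π ps) where

  step : ∀ n → PermStep (πs n) (πs (suc n)) (ps n)
  preproof : ∀ n → PreProof (πs n)

  step n with perm (πs n) (ps n) in e | proj₂ perm-seq n
  ... | just u | u≈ = PermStep-≈ u≈ (perm-step (ps n) (πs n) u (preproof n) e)

  preproof zero    = PreProof-≈ (λ q → sym (proj₁ perm-seq q)) π-pre
  preproof (suc n) = PermStep.preproof (step n)

  defined-π : ∀ n q → Defined (πs n) q → Defined π q
  defined-π zero    q (nd , e) = nd , trans (sym (proj₁ perm-seq q)) e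
  defined-π (suc n) q dq       = defined-π n q (PermStep-defined⁻ (step n) q dq)

  π-defined : ∀ n q → Defined π q → Defined (πs n) q
  π-defined zero    q (nd , e) = nd , trans (proj₁ perm-seq q) e
  π-defined (suc n) q dq       = PermStep-defined⁺ (step n) q (π-defined n q dq)

  resid : ℕ → Pos → Pos
  resid n q = residual ps q n

  -- The position in π of the rule found at position p of πs n.
  origin : ℕ → Pos → Pos
  origin zero    p = p
  origin (suc n) p = origin n (resStep (ps n) p)

  resid-origin : ∀ n p → resid n (origin n p) ≡ p
  resid-origin zero    p = refl
  resid-origin (suc n) p =
    trans (cong (resStep (ps n)) (resid-origin n (resStep (ps n) p))) (resStep-involutive (ps n) p)

  origin-resid : ∀ n q → origin n (resid n q) ≡ q
  origin-resid zero    q = refl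
  origin-resid (suc n) q =
    trans (cong (origin n) (resStep-involutive (ps n) (resid n q))) (origin-resid n q)

  resStep-defined : ∀ n q → Defined π q → Defined π (resStep (ps n) q)
  resStep-defined n q = resStep-preserves (Defined π) (ps n) q
    (defined-π n _ (PermStep-defined-at (step n))) (defined-π n _ (PermStep.defined-below (step n)))

  resid-defined : ∀ n q → Defined π q → Defined π (resid n q)
  resid-defined zero    q dq = dq
  resid-defined (suc n) q dq = resStep-defined n (resid n q) (resid-defined n q dq)

  origin-defined : ∀ n p → Defined π p → Defined π (origin n p)
  origin-defined zero    p dp = dp
  origin-defined (suc n) p dp = origin-defined n (resStep (ps n) p) (resStep-defined n p dp)

  stabTimeOf : ∀ q (x : Maybe Node) → π q ≡ x → ℕ
  stabTimeOf q nothing   _ = 0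
  stabTimeOf q (just nd) e = proj₁ (finite q nd e)

  stabTime : Pos → ℕ
  stabTime q = stabTimeOf q (π q) refl

  settled : ∀ q → Defined π q → ∀ m n → stabTime q ≤ m → stabTime q ≤ n → resid m q ≡ resid n q
  settled q (nd , e) = settledOf (π q) refl e
    where
    settledOf : ∀ x (e′ : π q ≡ x) → x ≡ just nd → ∀ m n →
                stabTimeOf q x e′ ≤ m → stabTimeOf q x e′ ≤ n → resid m q ≡ resid n q
    settledOf _ e′ refl m n sm sn =
      trans (proj₂ (finite q nd e′) m sm) (sym (proj₂ (finite q nd e′) n sn))

  -- The rule permuted at step n moves, so it has not settled by time n.
  permuted-unsettled : ∀ n → ¬ stabTime (origin n (ps n)) ≤ n
  permuted-unsettled n s≤n = p++i≢p (ps n) (trans (sym moved) (trans still (resid-origin n (ps n))))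
    where
    o : Pos
    o = origin n (ps n)
    o-defined : Defined π o
    o-defined = origin-defined n (ps n) (defined-π n (ps n) (PermStep-defined-at (step n)))
    moved : resid (suc n) o ≡ ps n ++ i ∷ []
    moved = trans (cong (resStep (ps n)) (resid-origin n (ps n))) (resStep-at (ps n))
    still : resid (suc n) o ≡ resid n o
    still = settled o o-defined (suc n) n (m≤n⇒m≤1+n s≤n) s≤n

  resid-injective : ∀ n {q q′} → resid n q ≡ resid n q′ → q ≡ q′
  resid-injective n {q} {q′} e =
    trans (sym (origin-resid n q)) (trans (cong (origin n) e) (origin-resid n q′))

  resid-lane : ∀ {c} → NoTrailingI c → ∀ n x → ∃ λ g → resid n (lane c x) ≡ lane c g
  resid-lane c-ok zero    x = x , refl
  resid-lane c-ok (suc n) x with resid-lane c-ok n x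
  ... | g , e with resStep-lane c-ok (ps n) g
  ...   | g′ , e′ = g′ , trans (cong (resStep (ps n)) e) e′

  laneIndex : ∀ {c} → NoTrailingI c → ℕ → ℕ → ℕ
  laneIndex c-ok n x = proj₁ (resid-lane c-ok n x)

  laneIndex-resid : ∀ {c} (c-ok : NoTrailingI c) n x → resid n (lane c x) ≡ lane c (laneIndex c-ok n x)
  laneIndex-resid c-ok n x = proj₂ (resid-lane c-ok n x)

  laneIndex-injective : ∀ {c} (c-ok : NoTrailingI c) n x y → laneIndex c-ok n x ≡ laneIndex c-ok n y → x ≡ y
  laneIndex-injective {c} c-ok n x y e = lane-injective c (resid-injective n
    (trans (laneIndex-resid c-ok n x) (trans (cong (lane c) e) (sym (laneIndex-resid c-ok n y)))))

  module Depth (d : ℕ) where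
    shallow : List Pos
    shallow = positionsUpTo (suc d)

    N₁ : ℕ
    N₁ = maxOver stabTime shallow

    settled-shallow : ∀ {q} → q ∈ shallow → Defined π q → ∀ n → N₁ ≤ n → resid n q ≡ resid N₁ q
    settled-shallow q∈ dq n N₁≤n =
      settled _ dq n N₁ (≤-trans (≤-maxOver stabTime q∈) N₁≤n) (≤-maxOver stabTime q∈)

    Anchored : Pos → Set
    Anchored y = ∃ λ q → q ∈ shallow × Defined π q × y ⊏ resid N₁ q

    -- Settled rules do not move, so the positions strictly above them are only permuted among themselves.
    anchored-step : ∀ m → N₁ ≤ m → ∀ y → Anchored y → Anchored (resStep (ps m) y)
    anchored-step m N₁≤m y a@(q , q∈ , dq , y⊏) with stepCase (ps m) y
    ... | elsewhere y≢p y≢pi = ≡-subst Anchored (sym (resStep-elsewhere y≢p y≢pi)) a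
    ... | below refl =
      ≡-subst Anchored (sym (resStep-below (ps m))) (q , q∈ , dq , ⊏-trans (⊏-++i (ps m)) y⊏)
    ... | at refl = ≡-subst Anchored (sym (resStep-at (ps m))) (q , q∈ , dq , ⊏-step y⊏ through-i not-below)
      where
      now : resid m q ≡ resid N₁ q
      now = settled-shallow q∈ dq m N₁≤m
      through-i : ∀ e rest → resid N₁ q ≡ ps m ++ e ∷ rest → e ≡ i
      through-i e rest eq =
        struct-premise-i (preproof m) (ps m) (proj₂ (proj₂ (proj₂ (PermStep.structural (step m))))) e rest
          (≡-subst (Defined (πs m)) (trans now eq) (π-defined m _ (resid-defined m q dq)))
      not-below : resid N₁ q ≢ ps m ++ i ∷ []
      not-below eq = p++i≢p (ps m) (begin
        ps m ++ i ∷ []                   ≡⟨ eq ⟨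
        resid N₁ q                       ≡⟨ settled-shallow q∈ dq (suc m) (m≤n⇒m≤1+n N₁≤m) ⟨
        resStep (ps m) (resid m q)       ≡⟨ cong (resStep (ps m)) (trans now eq) ⟩
        resStep (ps m) (ps m ++ i ∷ [])  ≡⟨ resStep-below (ps m) ⟩
        ps m                             ∎)

    origin-anchored : ∀ k y → Anchored y → ∃ λ y′ → Anchored y′ × origin (k + N₁) y ≡ origin N₁ y′
    origin-anchored zero    y a = y , a , refl
    origin-anchored (suc k) y a =
      origin-anchored k (resStep (ps (k + N₁)) y) (anchored-step (k + N₁) (m≤n+m N₁ k) y a)

    -- Pigeonhole along the lane through ps n: the j + 2 rules of π at lane positions 0, …, j + 1
    -- occupy distinct lane positions at time n, so one of them is strictly below ps n.
    shallow-step-anchored : ∀ n → N₁ ≤ n → length (ps n) ≤ d → Anchored (ps n)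
    shallow-step-anchored n N₁≤n short with lane-decomposition (ps n)
    ... | c , j , c-ok , ps≡ with injective-reaches (suc j) (laneIndex c-ok n) (laneIndex-injective c-ok n)
    ...   | x , x≤ , j<index = lane c x , q₀∈ , q₀-defined , ps⊏
      where
      q₀∈ : lane c x ∈ shallow
      q₀∈ = ∈-positionsUpTo (suc d) (lane c x)
              (≤-trans (≤-reflexive (length-lane c x)) (≤-trans (+-monoʳ-≤ (length c) x≤)
                (≤-trans (≤-reflexive (+-suc (length c) j))
                  (s≤s (≤-trans (≤-reflexive (sym (trans (cong length ps≡) (length-lane c j)))) short)))))
      below≡ : ps n ++ i ∷ [] ≡ lane c x ++ replicate (suc j ∸ x) i
      below≡ = trans (cong (_++ i ∷ []) ps≡) (trans (lane-suc c j)
                 (trans (cong (lane c) (sym (m+[n∸m]≡n x≤))) (lane-+ c x (suc j ∸ x))))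
      q₀-defined : Defined π (lane c x)
      q₀-defined = Defined-prefix π-pre (lane c x) (replicate (suc j ∸ x) i)
        (≡-subst (Defined π) below≡ (defined-π n _ (PermStep.defined-below (step n))))
      ps⊏ : ps n ⊏ resid N₁ (lane c x)
      ps⊏ = ≡-subst₂ _⊏_ (sym ps≡)
              (trans (sym (laneIndex-resid c-ok n x)) (settled-shallow q₀∈ q₀-defined n N₁≤n))
              (lane-⊏ c j<index)

    candidates : List Pos
    candidates = map (origin N₁) (concatMap (λ q → strictPrefixes (resid N₁ q)) shallow)

    N₂ : ℕ
    N₂ = N₁ ⊔ maxOver stabTime candidates

    N₁≤N₂ : N₁ ≤ N₂
    N₁≤N₂ = m≤m⊔n N₁ (maxOver stabTime candidates)

    candidate-settled : ∀ {o} → o ∈ candidates → stabTime o ≤ N₂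
    candidate-settled o∈ = ≤-trans (≤-maxOver stabTime o∈) (m≤n⊔m N₁ (maxOver stabTime candidates))

    anchored-candidate : ∀ y → Anchored y → origin N₁ y ∈ candidates
    anchored-candidate y (q , q∈ , _ , y⊏) =
      ∈-map⁺ (origin N₁)
        (∈-concatMap (λ q → strictPrefixes (resid N₁ q)) q∈ (∈-strictPrefixes y (resid N₁ q) y⊏))

    shallow-step-candidate : ∀ n → N₁ ≤ n → length (ps n) ≤ d → origin n (ps n) ∈ candidates
    shallow-step-candidate n N₁≤n short =
      let y′ , anchored , origin≡ = origin-anchored (n ∸ N₁) (ps n) (shallow-step-anchored n N₁≤n short)
      in ≡-subst (λ m → origin m (ps n) ∈ candidates) (m∸n+n≡m N₁≤n)
           (≡-subst (_∈ candidates) (sym origin≡) (anchored-candidate y′ anchored))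

    deep : ∀ n → N₂ ≤ n → d < length (ps n)
    deep n N₂≤n with suc d ≤? length (ps n)
    ... | yes d<ps = d<ps
    ... | no d≮ps  = ⊥-elim (permuted-unsettled n (≤-trans (candidate-settled origin∈) N₂≤n))
      where
      origin∈ : origin n (ps n) ∈ candidates
      origin∈ = shallow-step-candidate n (≤-trans N₁≤N₂ N₂≤n) (≤-pred (≰⇒> d≮ps))

  N : ℕ → ℕ
  N = Depth.N₂

  frozen-after : ∀ d k q → length q ≤ d → πs (k + N d) q ≡ πs (N d) q
  frozen-after d zero    q q≤d = refl
  frozen-after d (suc k) q q≤d =
    trans (PermStep.unchanged (step (k + N d)) q q≢p q≢pi) (frozen-after d k q q≤d)
    where
    d<p : d < length (ps (k + N d))
    d<p = Depth.deep d (k + N d) (m≤n+m (N d) k)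
    q≢p : q ≢ ps (k + N d)
    q≢p refl = <⇒≱ d<p q≤d
    q≢pi : q ≢ ps (k + N d) ++ i ∷ []
    q≢pi refl = <⇒≱ d<p (≤-trans (m≤m+n _ 1) (≤-trans (≤-reflexive (sym (length-++ (ps (k + N d))))) q≤d))

  frozen : ∀ d n → N d ≤ n → ∀ q → length q ≤ d → πs n q ≡ πs (N d) q
  frozen d n N≤n q q≤d =
    ≡-subst (λ m → πs m q ≡ πs (N d) q) (m∸n+n≡m N≤n) (frozen-after d (n ∸ N d) q q≤d)

  lim : Tree
  lim q = πs (N (length q)) q

  lim-agrees : ∀ d n → N d ≤ n → ∀ q → length q ≤ d → πs n q ≡ lim q
  lim-agrees d n N≤n q q≤d = begin
    πs n q      ≡⟨ frozen d n N≤n q q≤d ⟩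
    πs (N d) q  ≡⟨ frozen d M (≤-trans N≤n (m≤m⊔n n _)) q q≤d ⟨
    πs M q      ≡⟨ frozen (length q) M (m≤n⊔m n _) q ≤-refl ⟩
    lim q       ∎
    where
    M : ℕ
    M = n ⊔ N (length q)

  converges : ConvergesTo πs lim
  converges d = N d , λ n N≤n q q≤d → lim-agrees d n N≤n q q≤d

  lim-preproof : PreProof lim
  lim-preproof = proj₁ (preproof (N 0)) , local
    where
    local : ∀ q → LocalOK (lim q) (λ d → lim (q ++ d ∷ []))
    local q = ≡-subst (λ x → LocalOK x (λ d → lim (q ++ d ∷ []))) (agrees q (n≤1+n (length q)))
                (LocalOK-cong (πs n q) (λ d → cong seqOf (agrees (q ++ d ∷ []) (child≤ d)))
                  (proj₂ (preproof n) q))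
      where
      n : ℕ
      n = N (suc (length q))
      agrees : ∀ q′ → length q′ ≤ suc (length q) → πs n q′ ≡ lim q′
      agrees q′ = lim-agrees (suc (length q)) n ≤-refl q′
      child≤ : ∀ d → length (q ++ d ∷ []) ≤ suc (length q)
      child≤ d = ≤-reflexive (trans (length-++ q) (+-comm (length q) 1))

mainTheorem2 : (π : Tree) → PreProof π → (ps : ℕ → Pos) → (πs : ℕ → Tree) →
    IsPermSeq π ps πs → FinitePermutationOfRules π ps →
    Σ Tree (λ lim → PreProof lim × ConvergesTo πs lim)
mainTheorem2 π π-pre ps πs perm-seq finite = lim , lim-preproof , converges
  where open Convergence π π-pre ps πs perm-seq finite
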